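{- Let $\varphi,\psi$ be formulas such that $\varphi\vdash^{\leq}_{\mathbb{DM}}\psi$ (i.e., the rule $\frac{\varphi}{\psi}$ is sound for the Belnap–Dunn logic). Then $\varphi^*\vdash^{\leq}_{\mathbb{SDM}}\psi^*$.
   Context: Language: binary $\land,\lor$, unary $\neg$, constants $\bot,\top$. A distributive lattice with negation is an algebra $\langle A;\land,\lor,\neg,\bot,\top\rangle$ whose reduct is a bounded distributive lattice and which satisfies $\neg\bot\approx\top$, $\neg(x\lor y)\approx\neg x\land\neg y$. A semi-De Morgan algebra additionally satisfies $\neg\top\approx\bot$, $\neg\neg(x\land y)\approx\neg\neg x\land\neg\neg y$, $\neg x\approx\neg\neg\neg x$ (variety $\mathbb{SDM}$); a De Morgan algebra is a semi-De Morgan algebra satisfying $\neg\neg x\approx x$ (variety $\mathbb{DM}$). For a class $\mathbb{K}$, $\Gamma\vdash^{\leq}_{\mathbb{K}}\varphi$ iff for every $\mathbf{A}\in\mathbb{K}$, every non-empty lattice filter $F$ and every homomorphism $h$ from the formula algebra to $\mathbf{A}$, $h[\Gamma]\subseteq F$ implies $h(\varphi)\in F$. The translation $\varphi\mapsto\varphi^*$ is defined recursively: $\varphi^*=\neg\neg\varphi$ if $\varphi$ is a variable, $\top$ or $\bot$; $(\neg\varphi_1)^*=\neg\varphi_1^*$; $(\varphi_1\land\varphi_2)^*=\varphi_1^*\land\varphi_2^*$; $(\varphi_1\lor\varphi_2)^*=\neg\neg(\varphi_1^*\lor\varphi_2^*)$. -}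

module Defs where

open import Data.Nat using (ℕ)
open import Data.Product using (Σ; _×_)
open import Relation.Binary.PropositionalEquality using (_≡_)

data Fm : Set where
  var  : ℕ → Fm
  top  : Fm
  bot  : Fm
  neg  : Fm → Fm
  _and_ : Fm → Fm → Fm
  _or_  : Fm → Fm → Fm

infixr 7 _and_
infixr 6 _or_

_* : Fm → Fm
var x * = neg (neg (var x))
top *   = neg (neg top)
bot *   = neg (neg bot)
neg φ * = neg (φ *)
(φ and ψ) * = (φ *) and (ψ *)
(φ or ψ) *  = neg (neg ((φ *) or (ψ *)))

record Alg : Set₁ where
  field
    Carrier : Set
    _∧_ : Carrier → Carrier → Carrier
    _∨_ : Carrier → Carrier → Carrier
    ¬_  : Carrier → Carrier
    ⊥ ⊤ : Carrier

record IsDLN (A : Alg) : Set where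
  open Alg A
  field
    ∧-assoc : ∀ x y z → (x ∧ y) ∧ z ≡ x ∧ (y ∧ z)
    ∨-assoc : ∀ x y z → (x ∨ y) ∨ z ≡ x ∨ (y ∨ z)
    ∧-comm  : ∀ x y → x ∧ y ≡ y ∧ x
    ∨-comm  : ∀ x y → x ∨ y ≡ y ∨ x
    ∧-absorbs-∨ : ∀ x y → x ∧ (x ∨ y) ≡ x
    ∨-absorbs-∧ : ∀ x y → x ∨ (x ∧ y) ≡ x
    ∧-distrib-∨ : ∀ x y z → x ∧ (y ∨ z) ≡ (x ∧ y) ∨ (x ∧ z)
    ∧-identity  : ∀ x → x ∧ ⊤ ≡ x
    ∨-identity  : ∀ x → x ∨ ⊥ ≡ x
    ¬⊥≡⊤ : ¬ ⊥ ≡ ⊤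
    ¬-∨  : ∀ x y → ¬ (x ∨ y) ≡ (¬ x) ∧ (¬ y)

record IsSDM (A : Alg) : Set where
  open Alg A
  field
    isDLN : IsDLN A
    ¬⊤≡⊥  : ¬ ⊤ ≡ ⊥
    ¬¬-∧  : ∀ x y → ¬ (¬ (x ∧ y)) ≡ (¬ (¬ x)) ∧ (¬ (¬ y))
    ¬¬¬   : ∀ x → ¬ x ≡ ¬ (¬ (¬ x))

record IsDM (A : Alg) : Set where
  open Alg A
  field
    isSDM : IsSDM A
    ¬¬    : ∀ x → ¬ (¬ x) ≡ x

record IsHom (A : Alg) (h : Fm → Alg.Carrier A) : Set where
  open Alg A
  field
    h-top : h top ≡ ⊤
    h-bot : h bot ≡ ⊥
    h-neg : ∀ φ → h (neg φ) ≡ ¬ (h φ)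
    h-and : ∀ φ ψ → h (φ and ψ) ≡ h φ ∧ h ψ
    h-or  : ∀ φ ψ → h (φ or ψ) ≡ h φ ∨ h ψ

record IsFilter (A : Alg) (F : Alg.Carrier A → Set) : Set where
  open Alg A
  field
    nonempty : Σ Carrier F
    up-closed : ∀ a b → F a → a ∧ b ≡ a → F b
    ∧-closed  : ∀ a b → F a → F b → F (a ∧ b)

_⊢≤[_]_ : Fm → (Alg → Set) → Fm → Set₁
φ ⊢≤[ K ] ψ = (A : Alg) → K A → (F : Alg.Carrier A → Set) → IsFilter A F →
  (h : Fm → Alg.Carrier A) → IsHom A h → F (h φ) → F (h ψ)

{-# OPTIONS --safe #-}
module Submission where

-- The regular elements (¬ ¬ x ≡ x) of a semi-De Morgan algebra form a De Morgan
-- algebra under ∧, ¬, ⊥, ⊤ and the join ¬ ¬ (x ∨ y).  For a homomorphism h, the map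
-- φ ↦ h (φ *) takes regular values and is a homomorphism into that algebra, and a
-- filter restricts to a filter of it; so a DM-sound rule applied there yields the
-- translated rule in the original algebra.

open import Defs
open import Data.Product using (Σ; _,_; proj₁; proj₂)
open import Relation.Binary.PropositionalEquality
  using (_≡_; refl; sym; trans; cong; cong₂; subst; module ≡-Reasoning)
open import Axiom.UniquenessOfIdentityProofs.WithK using (uip)

module RegularElements (A : Alg) (isSDM : IsSDM A) where
  open Alg A
  open IsSDM isSDM
  open IsDLN isDLN
  open ≡-Reasoning

  ¬¬ : Carrier → Carrier
  ¬¬ x = ¬ (¬ x)

  IsRegular : Carrier → Set
  IsRegular x = ¬¬ x ≡ x

  ¬-regular : ∀ x → IsRegular (¬ x)
  ¬-regular x = sym (¬¬¬ x)

  ∧-regular : ∀ {x y} → IsRegular x → IsRegular y → IsRegular (x ∧ y)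
  ∧-regular {x} {y} rx ry = trans (¬¬-∧ x y) (cong₂ _∧_ rx ry)

  ⊤-regular : IsRegular ⊤
  ⊤-regular = trans (cong ¬_ ¬⊤≡⊥) ¬⊥≡⊤

  ⊥-regular : IsRegular ⊥
  ⊥-regular = trans (cong ¬_ ¬⊥≡⊤) ¬⊤≡⊥

  ¬-∨-¬¬ˡ : ∀ x y → ¬ (¬¬ x ∨ y) ≡ ¬ (x ∨ y)
  ¬-∨-¬¬ˡ x y = begin
    ¬ (¬¬ x ∨ y)          ≡⟨ ¬-∨ (¬¬ x) y ⟩
    (¬ (¬¬ x)) ∧ (¬ y)    ≡⟨ cong (_∧ (¬ y)) (sym (¬¬¬ x)) ⟩
    (¬ x) ∧ (¬ y)         ≡⟨ sym (¬-∨ x y) ⟩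
    ¬ (x ∨ y)             ∎

  ¬¬-∧-regularˡ : ∀ {x} y → IsRegular x → x ∧ ¬¬ y ≡ ¬¬ (x ∧ y)
  ¬¬-∧-regularˡ {x} y rx = begin
    x ∧ ¬¬ y      ≡⟨ cong (_∧ ¬¬ y) (sym rx) ⟩
    ¬¬ x ∧ ¬¬ y   ≡⟨ sym (¬¬-∧ x y) ⟩
    ¬¬ (x ∧ y)    ∎

  ¬¬-∨-assoc : ∀ x y z → ¬¬ (¬¬ (x ∨ y) ∨ z) ≡ ¬¬ (x ∨ ¬¬ (y ∨ z))
  ¬¬-∨-assoc x y z = begin
    ¬¬ (¬¬ (x ∨ y) ∨ z)    ≡⟨ cong ¬_ (¬-∨-¬¬ˡ (x ∨ y) z) ⟩
    ¬¬ ((x ∨ y) ∨ z)       ≡⟨ cong ¬¬ (∨-assoc x y z) ⟩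
    ¬¬ (x ∨ (y ∨ z))       ≡⟨ cong ¬¬ (∨-comm x (y ∨ z)) ⟩
    ¬¬ ((y ∨ z) ∨ x)       ≡⟨ cong ¬_ (sym (¬-∨-¬¬ˡ (y ∨ z) x)) ⟩
    ¬¬ (¬¬ (y ∨ z) ∨ x)    ≡⟨ cong ¬¬ (∨-comm _ x) ⟩
    ¬¬ (x ∨ ¬¬ (y ∨ z))    ∎

  Regular : Set
  Regular = Σ Carrier IsRegular

  regular-≡ : {a b : Regular} → proj₁ a ≡ proj₁ b → a ≡ b
  regular-≡ {x , rx} {.x , ry} refl = cong (x ,_) (uip rx ry)

  regularAlg : Alg
  regularAlg = record
    { Carrier = Regular
    ; _∧_ = λ (x , rx) (y , ry) → x ∧ y , ∧-regular rx ry
    ; _∨_ = λ (x , _) (y , _) → ¬¬ (x ∨ y) , ¬-regular _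
    ; ¬_  = λ (x , _) → ¬ x , ¬-regular x
    ; ⊥   = ⊥ , ⊥-regular
    ; ⊤   = ⊤ , ⊤-regular
    }

  regularAlg-isDM : IsDM regularAlg
  regularAlg-isDM = record
    { isSDM = record
      { isDLN = record
        { ∧-assoc = λ _ _ _ → regular-≡ (∧-assoc _ _ _)
        ; ∨-assoc = λ (x , _) (y , _) (z , _) → regular-≡ (¬¬-∨-assoc x y z)
        ; ∧-comm = λ _ _ → regular-≡ (∧-comm _ _)
        ; ∨-comm = λ _ _ → regular-≡ (cong ¬¬ (∨-comm _ _))
        ; ∧-absorbs-∨ = λ (x , rx) (y , _) → regular-≡
            (trans (¬¬-∧-regularˡ (x ∨ y) rx) (trans (cong ¬¬ (∧-absorbs-∨ x y)) rx))
        ; ∨-absorbs-∧ = λ (x , rx) (y , _) → regular-≡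
            (trans (cong ¬¬ (∨-absorbs-∧ x y)) rx)
        ; ∧-distrib-∨ = λ (x , rx) (y , _) (z , _) → regular-≡
            (trans (¬¬-∧-regularˡ (y ∨ z) rx) (cong ¬¬ (∧-distrib-∨ x y z)))
        ; ∧-identity = λ _ → regular-≡ (∧-identity _)
        ; ∨-identity = λ (x , rx) → regular-≡ (trans (cong ¬¬ (∨-identity x)) rx)
        ; ¬⊥≡⊤ = regular-≡ ¬⊥≡⊤
        ; ¬-∨ = λ _ _ → regular-≡ (trans (sym (¬¬¬ _)) (¬-∨ _ _))
        }
      ; ¬⊤≡⊥ = regular-≡ ¬⊤≡⊥
      ; ¬¬-∧ = λ (_ , rx) (_ , ry) → regular-≡
          (trans (∧-regular rx ry) (sym (cong₂ _∧_ rx ry)))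
      ; ¬¬¬ = λ _ → regular-≡ (¬¬¬ _)
      }
    ; ¬¬ = λ (_ , rx) → regular-≡ rx
    }

  module _ (h : Fm → Carrier) (isHom : IsHom A h) where
    open IsHom isHom

    h-neg-neg : ∀ φ → h (neg (neg φ)) ≡ ¬¬ (h φ)
    h-neg-neg φ = trans (h-neg (neg φ)) (cong ¬_ (h-neg φ))

    h-neg-neg-regular : ∀ φ → IsRegular (h (neg (neg φ)))
    h-neg-neg-regular φ = subst IsRegular (sym (h-neg-neg φ)) (¬-regular _)

    h-*-regular : ∀ φ → IsRegular (h (φ *))
    h-*-regular (var x)   = h-neg-neg-regular (var x)
    h-*-regular top       = h-neg-neg-regular top
    h-*-regular bot       = h-neg-neg-regular bot
    h-*-regular (neg φ)   = subst IsRegular (sym (h-neg (φ *))) (¬-regular _)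
    h-*-regular (φ and ψ) =
      subst IsRegular (sym (h-and (φ *) (ψ *))) (∧-regular (h-*-regular φ) (h-*-regular ψ))
    h-*-regular (φ or ψ)  = h-neg-neg-regular ((φ *) or (ψ *))

    h* : Fm → Regular
    h* φ = h (φ *) , h-*-regular φ

    h*-isHom : IsHom regularAlg h*
    h*-isHom = record
      { h-top = regular-≡ (trans (h-neg-neg top) (trans (cong ¬¬ h-top) ⊤-regular))
      ; h-bot = regular-≡ (trans (h-neg-neg bot) (trans (cong ¬¬ h-bot) ⊥-regular))
      ; h-neg = λ φ → regular-≡ (h-neg (φ *))
      ; h-and = λ φ ψ → regular-≡ (h-and (φ *) (ψ *))
      ; h-or  = λ φ ψ → regular-≡ (trans (h-neg-neg _) (cong ¬¬ (h-or (φ *) (ψ *))))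
      }

  module _ (F : Carrier → Set) (isFilter : IsFilter A F) where
    open IsFilter isFilter

    restrict : Regular → Set
    restrict (x , _) = F x

    restrict-isFilter : IsFilter regularAlg restrict
    restrict-isFilter = record
      { nonempty  = (⊤ , ⊤-regular) , up-closed _ ⊤ (proj₂ nonempty) (∧-identity _)
      ; up-closed = λ _ _ Fa a∧b≡a → up-closed _ _ Fa (cong proj₁ a∧b≡a)
      ; ∧-closed  = λ _ _ Fa Fb → ∧-closed _ _ Fa Fb
      }

lemma2p6 : (φ ψ : Fm) → φ ⊢≤[ IsDM ] ψ → (φ *) ⊢≤[ IsSDM ] (ψ *)
lemma2p6 φ ψ φ⊢ψ A isSDM F isFilter h isHom =
  φ⊢ψ regularAlg regularAlg-isDM
      (restrict F isFilter) (restrict-isFilter F isFilter)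
      (h* h isHom) (h*-isHom h isHom)
  where open RegularElements A isSDM
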